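{- Let $N_1,N_2\in\mathcal{B}$ be non-complementary, and $M_1,M_2\in\mathcal{B}$ be the two remaining bases. The code $\mathcal{C}$ contains at least one of $N_1N_1N_2$, $N_2N_2N_1$, $M_1M_1M_2$ and $M_2M_2M_1$.
   Context: Let $\mathcal{B}=\{\mathtt{A},\mathtt{C},\mathtt{G},\mathtt{T}\}$ be the genetic alphabet, and let $c\colon\mathcal{B}\to\mathcal{B}$ be the complementarity map $c(\mathtt{A})=\mathtt{T}$, $c(\mathtt{T})=\mathtt{A}$, $c(\mathtt{C})=\mathtt{G}$, $c(\mathtt{G})=\mathtt{C}$. For a codon $w=N_1N_2N_3\in\mathcal{B}^3$ its reverse complement is $\overleftarrow{c}(w)=c(N_3)c(N_2)c(N_1)$, and $\alpha(N_1N_2N_3)=N_3N_1N_2$ is the cyclic shift. A set of 3-letter words is a circular code if any concatenation of its words written on a circle can be decomposed into a concatenation of its words in a unique way. Here $\mathcal{C}$ is a maximal $C^3$ circular code: a circular code with $|\mathcal{C}|=20$, $\overleftarrow{c}(\mathcal{C})=\mathcal{C}$, and $\alpha(\mathcal{C})$ (hence also $\alpha^2(\mathcal{C})$) circular. -}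

module Defs where

open import Data.List using (List; []; _∷_; _++_; concat; map; length)
open import Data.List.Membership.Propositional using (_∈_)
open import Data.List.Relation.Unary.All using (All)
open import Data.List.Relation.Unary.Unique.Propositional using (Unique)
open import Data.Product using (_×_; _,_)
open import Data.Nat using (ℕ)
open import Relation.Binary.PropositionalEquality using (_≡_)
open import Relation.Nullary using (¬_)
open import Function.Bundles using (_⇔_)

data Base : Set where
  A C G T : Base

comp : Base → Base
comp A = T
comp T = A
comp C = G
comp G = C

Codon : Set
Codon = Base × Base × Base

codon : Base → Base → Base → Codon
codon n₁ n₂ n₃ = n₁ , n₂ , n₃

word : Codon → List Base
word (n₁ , n₂ , n₃) = n₁ ∷ n₂ ∷ n₃ ∷ []

revComp : Codon → Codon
revComp (n₁ , n₂ , n₃) = comp n₃ , comp n₂ , comp n₁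

α : Codon → Codon
α (n₁ , n₂ , n₃) = n₃ , n₁ , n₂

-- A code is a finite set of codons, represented as a duplicate-free list.
Code : Set
Code = List Codon

flatten : List Codon → List Base
flatten xs = concat (map word xs)

-- Circular code (standard definition, Berstel–Perrin / Arquès–Michel):
-- X is circular iff for all x₁,…,xₙ, y₁,…,yₘ ∈ X (n,m ≥ 1), p ∈ B*, s ∈ B⁺,
-- s x₂⋯xₙ p = y₁⋯yₘ and x₁ = p s imply n = m, p = ε and xᵢ = yᵢ for all i.
IsCircular : Code → Set
IsCircular X =
  ∀ (x₁ : Codon) (xs : List Codon) (y₁ : Codon) (ys : List Codon)
    (p s : List Base) →
  All (_∈ X) (x₁ ∷ xs) → All (_∈ X) (y₁ ∷ ys) →
  ¬ (s ≡ []) →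
  s ++ flatten xs ++ p ≡ flatten (y₁ ∷ ys) →
  word x₁ ≡ p ++ s →
  (p ≡ []) × (x₁ ∷ xs ≡ y₁ ∷ ys)

image : (Codon → Codon) → Code → Code
image f X = map f X

SameSet : Code → Code → Set
SameSet X Y = ∀ w → (w ∈ X) ⇔ (w ∈ Y)

-- Maximal C³ circular code: circular, |C| = 20, c←(C) = C, α(C) circular
-- (α²(C) circular is then implied, per the paper's definition).
IsMaximalC3 : Code → Set
IsMaximalC3 X =
  Unique X × length X ≡ 20 × IsCircular X ×
  SameSet (image revComp X) X × IsCircular (image α X)

-- A circular code never contains both u and α u, hence no periodic codon and at
-- most one codon from each of the 20 conjugacy classes of non-periodic codons; as
-- |C| = 20, C meets every class. Since N₁ and N₂ are non-complementary,
-- {M₁, M₂} = {c(N₁), c(N₂)}. The class of N₁N₁N₂ meets C in N₁N₁N₂, in N₂N₁N₁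
-- (whose reverse complement c(N₁)c(N₁)c(N₂) then lies in C), or in N₁N₂N₁; likewise
-- for N₂N₂N₁. The alternating codons N₁N₂N₁ and N₂N₁N₂ cannot both lie in C, since
-- their product read around a circle also factors from its second letter on.
-- Only circularity of C, |C| = 20 and c←(C) = C are needed.
module Submission where

open import Defs
open import Data.Bool using (true; false; if_then_else_)
open import Data.List using (List; []; _∷_; map; length)
open import Data.List.Membership.Propositional using (_∈_; _∉_)
open import Data.List.Membership.Propositional.Properties using (∈-map⁺; ∈-map⁻)
open import Data.List.Properties using (length-map; length-removeAt′)
open import Data.List.Relation.Binary.Subset.Propositional using (_⊆_)
open import Data.List.Relation.Unary.All as All using (All; []; _∷_)
open import Data.List.Relation.Unary.All.Properties using (¬Any⇒All¬; map⁺)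
open import Data.List.Relation.Unary.Any using (here; there; any?; index; _─_)
open import Data.List.Relation.Unary.Unique.Propositional using (Unique; []; _∷_)
open import Data.Nat using (ℕ; _+_; _*_; _≤_; _≤ᵇ_; z≤n; s≤s)
open import Data.Nat.Properties using (≤-trans; ≤-reflexive; 1+n≰n; module ≤-Reasoning)
open import Data.Product as Product using (_×_; _,_; proj₁; proj₂; ∃-syntax)
open import Data.Product.Properties using (≡-dec)
open import Data.Sum using (_⊎_; inj₁; inj₂; map₂; swap)
open import Function using (_∘_)
open import Function.Bundles using (Equivalence)
open import Relation.Binary.Definitions using (DecidableEquality)
open import Relation.Binary.PropositionalEquality
  using (_≡_; _≢_; refl; sym; cong; subst; ≢-sym)
open import Relation.Nullary using (¬_; Dec; yes; no; contradiction)
open import Relation.Nullary.Decidable using (map′; toWitness; ¬?; _×-dec_; _⊎-dec_; _→-dec_)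

module _ {a} {A : Set a} where

  ∈-─⁺ : ∀ {x z : A} {ys} (x∈ys : x ∈ ys) → z ∈ ys → z ≢ x → z ∈ (ys ─ x∈ys)
  ∈-─⁺ (here refl) (here refl) z≢x = contradiction refl z≢x
  ∈-─⁺ (here refl) (there z∈ys) _   = z∈ys
  ∈-─⁺ (there x∈ys) (here refl) _   = here refl
  ∈-─⁺ (there x∈ys) (there z∈ys) z≢x = there (∈-─⁺ x∈ys z∈ys z≢x)

  Unique-⊆⇒length≤ : ∀ {xs ys : List A} → Unique xs → xs ⊆ ys → length xs ≤ length ys
  Unique-⊆⇒length≤ [] _ = z≤n
  Unique-⊆⇒length≤ {x ∷ xs} {ys} (x∉xs ∷ xs!) xs⊆ys = begin
    1 + length xs            ≤⟨ s≤s (Unique-⊆⇒length≤ xs! xs⊆ys─x) ⟩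
    1 + length (ys ─ x∈ys)   ≡⟨ sym (length-removeAt′ ys (index x∈ys)) ⟩
    length ys                ∎
    where
    open ≤-Reasoning
    x∈ys = xs⊆ys (here refl)
    xs⊆ys─x : xs ⊆ (ys ─ x∈ys)
    xs⊆ys─x z∈xs = ∈-─⁺ x∈ys (xs⊆ys (there z∈xs)) (≢-sym (All.lookup x∉xs z∈xs))

  Unique-⊆-length⇒⊇ : DecidableEquality A → ∀ {xs ys : List A} →
    Unique xs → xs ⊆ ys → length ys ≤ length xs → ys ⊆ xs
  Unique-⊆-length⇒⊇ _≟_ {xs} {ys} xs! xs⊆ys |ys|≤|xs| {y} y∈ys with any? (y ≟_) xs
  ... | yes y∈xs = y∈xs
  ... | no  y∉xs = contradiction (≤-trans |y∷xs|≤|ys| |ys|≤|xs|) 1+n≰n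
    where
    y∷xs⊆ys : y ∷ xs ⊆ ys
    y∷xs⊆ys (here refl) = y∈ys
    y∷xs⊆ys (there z∈xs) = xs⊆ys z∈xs
    |y∷xs|≤|ys| = Unique-⊆⇒length≤ (¬Any⇒All¬ xs y∉xs ∷ xs!) y∷xs⊆ys

  Unique-map⁺ : ∀ {b} {B : Set b} (f : A → B) {xs : List A} →
    (∀ {x y} → x ∈ xs → y ∈ xs → f x ≡ f y → x ≡ y) →
    Unique xs → Unique (map f xs)
  Unique-map⁺ f inj [] = []
  Unique-map⁺ f inj (x∉xs ∷ xs!) =
    map⁺ (All.tabulate λ y∈xs fx≡fy → All.lookup x∉xs y∈xs (inj (here refl) (there y∈xs) fx≡fy))
      ∷ Unique-map⁺ f (λ x∈xs y∈xs → inj (there x∈xs) (there y∈xs)) xs!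

_≟_ : DecidableEquality Base
A ≟ A = yes refl
A ≟ C = no λ ()
A ≟ G = no λ ()
A ≟ T = no λ ()
C ≟ A = no λ ()
C ≟ C = yes refl
C ≟ G = no λ ()
C ≟ T = no λ ()
G ≟ A = no λ ()
G ≟ C = no λ ()
G ≟ G = yes refl
G ≟ T = no λ ()
T ≟ A = no λ ()
T ≟ C = no λ ()
T ≟ G = no λ ()
T ≟ T = yes refl

_≟ᶜ_ : DecidableEquality Codon
_≟ᶜ_ = ≡-dec _≟_ (≡-dec _≟_ _≟_)

∀-Base? : {P : Base → Set} → (∀ x → Dec (P x)) → Dec (∀ x → P x)
∀-Base? P? = map′ (λ { (pA , pC , pG , pT) → λ { A → pA ; C → pC ; G → pG ; T → pT } })
                   (λ p → p A , p C , p G , p T)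
                   (P? A ×-dec P? C ×-dec P? G ×-dec P? T)

∀-Codon? : {P : Codon → Set} → (∀ w → Dec (P w)) → Dec (∀ w → P w)
∀-Codon? P? = map′ (λ p (x , y , z) → p x y z) (λ p x y z → p (x , y , z))
                   (∀-Base? λ x → ∀-Base? λ y → ∀-Base? λ z → P? (x , y , z))

other-bases-are-complements : ∀ {x y z} → x ≢ y → comp x ≢ y → z ≢ x → z ≢ y →
  z ≡ comp x ⊎ z ≡ comp y
other-bases-are-complements {x} {y} {z} = toWitness {a? = check} _ x y z
  where
  check = ∀-Base? λ x → ∀-Base? λ y → ∀-Base? λ z →
    ¬? (x ≟ y) →-dec ¬? (comp x ≟ y) →-dec ¬? (z ≟ x) →-dec ¬? (z ≟ y) →-dec
      (z ≟ comp x ⊎-dec z ≟ comp y)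

remaining-bases-are-complements : ∀ {N₁ N₂ M₁ M₂} →
  N₁ ≢ N₂ → comp N₁ ≢ N₂ → M₁ ≢ M₂ → M₁ ≢ N₁ → M₁ ≢ N₂ → M₂ ≢ N₁ → M₂ ≢ N₂ →
  (M₁ ≡ comp N₁ × M₂ ≡ comp N₂) ⊎ (M₁ ≡ comp N₂ × M₂ ≡ comp N₁)
remaining-bases-are-complements N₁≢N₂ cN₁≢N₂ M₁≢M₂ M₁≢N₁ M₁≢N₂ M₂≢N₁ M₂≢N₂
  with other-bases-are-complements N₁≢N₂ cN₁≢N₂ M₁≢N₁ M₁≢N₂
     | other-bases-are-complements N₁≢N₂ cN₁≢N₂ M₂≢N₁ M₂≢N₂
... | inj₁ refl | inj₁ refl = contradiction refl M₁≢M₂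
... | inj₁ M₁≡ | inj₂ M₂≡ = inj₁ (M₁≡ , M₂≡)
... | inj₂ M₁≡ | inj₁ M₂≡ = inj₂ (M₁≡ , M₂≡)
... | inj₂ refl | inj₂ refl = contradiction refl M₁≢M₂

Conjugate : Codon → Codon → Set
Conjugate u v = v ≡ u ⊎ v ≡ α u ⊎ v ≡ α (α u)

conjugate-euclidean : ∀ {u v w} → Conjugate u w → Conjugate v w → Conjugate u v
conjugate-euclidean {_ , _ , _} {_ , _ , _} (inj₁ refl)        (inj₁ refl)        = inj₁ refl
conjugate-euclidean {_ , _ , _} {_ , _ , _} (inj₁ refl)        (inj₂ (inj₁ refl)) = inj₂ (inj₂ refl)
conjugate-euclidean {_ , _ , _} {_ , _ , _} (inj₁ refl)        (inj₂ (inj₂ refl)) = inj₂ (inj₁ refl)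
conjugate-euclidean {_ , _ , _} {_ , _ , _} (inj₂ (inj₁ refl)) (inj₁ refl)        = inj₂ (inj₁ refl)
conjugate-euclidean {_ , _ , _} {_ , _ , _} (inj₂ (inj₁ refl)) (inj₂ (inj₁ refl)) = inj₁ refl
conjugate-euclidean {_ , _ , _} {_ , _ , _} (inj₂ (inj₁ refl)) (inj₂ (inj₂ refl)) = inj₂ (inj₂ refl)
conjugate-euclidean {_ , _ , _} {_ , _ , _} (inj₂ (inj₂ refl)) (inj₁ refl)        = inj₂ (inj₂ refl)
conjugate-euclidean {_ , _ , _} {_ , _ , _} (inj₂ (inj₂ refl)) (inj₂ (inj₁ refl)) = inj₂ (inj₁ refl)
conjugate-euclidean {_ , _ , _} {_ , _ , _} (inj₂ (inj₂ refl)) (inj₂ (inj₂ refl)) = inj₁ refl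

rank : Base → ℕ
rank A = 0
rank C = 1
rank G = 2
rank T = 3

lexRank : Codon → ℕ
lexRank (x , y , z) = 16 * rank x + 4 * rank y + rank z

lexMin : Codon → Codon → Codon
lexMin u v = if lexRank u ≤ᵇ lexRank v then u else v

lexMin-sel : ∀ u v → lexMin u v ≡ u ⊎ lexMin u v ≡ v
lexMin-sel u v with lexRank u ≤ᵇ lexRank v
... | true  = inj₁ refl
... | false = inj₂ refl

leastConjugate : Codon → Codon
leastConjugate w = lexMin w (lexMin (α w) (α (α w)))

conjugate-leastConjugate : ∀ w → Conjugate w (leastConjugate w)
conjugate-leastConjugate w with lexMin-sel w (lexMin (α w) (α (α w)))
                              | lexMin-sel (α w) (α (α w))
... | inj₁ ≡w | _        = inj₁ ≡w
... | inj₂ ≡m | inj₁ m≡  = inj₂ (inj₁ (subst (leastConjugate w ≡_) m≡ ≡m))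
... | inj₂ ≡m | inj₂ m≡  = inj₂ (inj₂ (subst (leastConjugate w ≡_) m≡ ≡m))

leastConjugate-≡⇒conjugate : ∀ {u v} → leastConjugate u ≡ leastConjugate v → Conjugate u v
leastConjugate-≡⇒conjugate {u} {v} u≈v =
  conjugate-euclidean (conjugate-leastConjugate u)
                      (subst (Conjugate v) (sym u≈v) (conjugate-leastConjugate v))

-- The lexicographically least codons of the 20 conjugacy classes of non-periodic codons.
representatives : List Codon
representatives =
  (A , A , C) ∷ (A , A , G) ∷ (A , A , T) ∷ (A , C , C) ∷ (A , C , G) ∷
  (A , C , T) ∷ (A , G , C) ∷ (A , G , G) ∷ (A , G , T) ∷ (A , T , C) ∷
  (A , T , G) ∷ (A , T , T) ∷ (C , C , G) ∷ (C , C , T) ∷ (C , G , G) ∷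
  (C , G , T) ∷ (C , T , G) ∷ (C , T , T) ∷ (G , G , T) ∷ (G , T , T) ∷ []

leastConjugate-∈-representatives : ∀ w → α w ≢ w → leastConjugate w ∈ representatives
leastConjugate-∈-representatives = toWitness {a? = check} _
  where
  check = ∀-Codon? λ w → ¬? (α w ≟ᶜ w) →-dec any? (leastConjugate w ≟ᶜ_) representatives

module _ {X : Code} (circular : IsCircular X) where

  circular⇒α∉ : ∀ {u} → u ∈ X → α u ∉ X
  circular⇒α∉ {x , y , z} u∈X αu∈X
    with () , _ ← circular (x , y , z) [] (z , x , y) [] (x ∷ y ∷ []) (z ∷ [])
                           (u∈X ∷ []) (αu∈X ∷ []) (λ ()) refl refl

  circular⇒aperiodic : ∀ {u} → u ∈ X → α u ≢ u
  circular⇒aperiodic u∈X αu≡u = circular⇒α∉ u∈X (subst (_∈ X) (sym αu≡u) u∈X)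

  circular⇒¬alternating : ∀ {x y} → (x , y , x) ∈ X → (y , x , y) ∉ X
  circular⇒¬alternating {x} {y} xyx∈X yxy∈X
    with () , _ ← circular (x , y , x) ((y , x , y) ∷ []) (y , x , y) ((x , y , x) ∷ [])
                           (x ∷ []) (y ∷ x ∷ []) (xyx∈X ∷ yxy∈X ∷ []) (yxy∈X ∷ xyx∈X ∷ [])
                           (λ ()) refl refl

  circular-conjugate⇒≡ : ∀ {u v} → u ∈ X → v ∈ X → Conjugate u v → u ≡ v
  circular-conjugate⇒≡ _ _ (inj₁ refl) = refl
  circular-conjugate⇒≡ u∈X v∈X (inj₂ (inj₁ refl)) = contradiction v∈X (circular⇒α∉ u∈X)
  circular-conjugate⇒≡ {_ , _ , _} u∈X v∈X (inj₂ (inj₂ refl)) =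
    contradiction u∈X (circular⇒α∉ v∈X)

  leastConjugate-injective : ∀ {u v} → u ∈ X → v ∈ X →
    leastConjugate u ≡ leastConjugate v → u ≡ v
  leastConjugate-injective u∈X v∈X = circular-conjugate⇒≡ u∈X v∈X ∘ leastConjugate-≡⇒conjugate

  leastConjugates⊆representatives : map leastConjugate X ⊆ representatives
  leastConjugates⊆representatives k∈ with u , u∈X , refl ← ∈-map⁻ leastConjugate k∈ =
    leastConjugate-∈-representatives u (circular⇒aperiodic u∈X)

  -- Opaque: otherwise a `with` on its result makes Agda normalise this proof and run out of memory.
  opaque
    circular-20⇒conjugate-∈ : Unique X → 20 ≤ length X →
      ∀ w → α w ≢ w → ∃[ v ] v ∈ X × Conjugate w v
    circular-20⇒conjugate-∈ X! 20≤|X| w aperiodic =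
      Product.map₂ (Product.map₂ leastConjugate-≡⇒conjugate)
        (∈-map⁻ leastConjugate (representatives⊆leastConjugates
          (leastConjugate-∈-representatives w aperiodic)))
      where
      representatives⊆leastConjugates : representatives ⊆ map leastConjugate X
      representatives⊆leastConjugates = Unique-⊆-length⇒⊇ _≟ᶜ_
        (Unique-map⁺ leastConjugate leastConjugate-injective X!)
        leastConjugates⊆representatives
        (subst (20 ≤_) (sym (length-map leastConjugate X)) 20≤|X|)

module _ {X : Code} (maximal : IsMaximalC3 X) where

  private
    X! = proj₁ maximal
    |X|≡20 = proj₁ (proj₂ maximal)
    circular = proj₁ (proj₂ (proj₂ maximal))
    self-complementary = proj₁ (proj₂ (proj₂ (proj₂ maximal)))

  revComp-∈ : ∀ {u} → u ∈ X → revComp u ∈ X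
  revComp-∈ {u} u∈X = Equivalence.to (self-complementary (revComp u)) (∈-map⁺ revComp u∈X)

  xxy-conjugate-∈ : ∀ {x y} → x ≢ y → (x , x , y) ∈ X ⊎ (y , x , x) ∈ X ⊎ (x , y , x) ∈ X
  xxy-conjugate-∈ {x} {y} x≢y
    with circular-20⇒conjugate-∈ circular X! (≤-reflexive (sym |X|≡20))
                                 (x , x , y) (x≢y ∘ sym ∘ cong proj₁)
  ... | _ , v∈X , inj₁ refl        = inj₁ v∈X
  ... | _ , v∈X , inj₂ (inj₁ refl) = inj₂ (inj₁ v∈X)
  ... | _ , v∈X , inj₂ (inj₂ refl) = inj₂ (inj₂ v∈X)

  xxy-or-yyx-or-complement-∈ : ∀ {x y} → x ≢ y →
    (x , x , y) ∈ X ⊎ (y , y , x) ∈ X ⊎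
    (comp x , comp x , comp y) ∈ X ⊎ (comp y , comp y , comp x) ∈ X
  xxy-or-yyx-or-complement-∈ x≢y with xxy-conjugate-∈ x≢y | xxy-conjugate-∈ (x≢y ∘ sym)
  ... | inj₁ xxy∈X        | _                 = inj₁ xxy∈X
  ... | inj₂ (inj₁ yxx∈X) | _                 = inj₂ (inj₂ (inj₁ (revComp-∈ yxx∈X)))
  ... | inj₂ (inj₂ _)     | inj₁ yyx∈X        = inj₂ (inj₁ yyx∈X)
  ... | inj₂ (inj₂ _)     | inj₂ (inj₁ xyy∈X) = inj₂ (inj₂ (inj₂ (revComp-∈ xyy∈X)))
  ... | inj₂ (inj₂ xyx∈X) | inj₂ (inj₂ yxy∈X) = contradiction yxy∈X (circular⇒¬alternating circular xyx∈X)

mainTheorem3 : (X : Code) → IsMaximalC3 X →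
    (N₁ N₂ M₁ M₂ : Base) →
    ¬ (N₁ ≡ N₂) → ¬ (comp N₁ ≡ N₂) →
    ¬ (M₁ ≡ M₂) → ¬ (M₁ ≡ N₁) → ¬ (M₁ ≡ N₂) → ¬ (M₂ ≡ N₁) → ¬ (M₂ ≡ N₂) →
    (codon N₁ N₁ N₂ ∈ X) ⊎ (codon N₂ N₂ N₁ ∈ X) ⊎
    (codon M₁ M₁ M₂ ∈ X) ⊎ (codon M₂ M₂ M₁ ∈ X)
mainTheorem3 X maximal N₁ N₂ M₁ M₂ N₁≢N₂ cN₁≢N₂ M₁≢M₂ M₁≢N₁ M₁≢N₂ M₂≢N₁ M₂≢N₂
  with remaining-bases-are-complements N₁≢N₂ cN₁≢N₂ M₁≢M₂ M₁≢N₁ M₁≢N₂ M₂≢N₁ M₂≢N₂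
... | inj₁ (refl , refl) = xxy-or-yyx-or-complement-∈ maximal N₁≢N₂
... | inj₂ (refl , refl) = map₂ (map₂ swap) (xxy-or-yyx-or-complement-∈ maximal N₁≢N₂)
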